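{- Let $G$ be the directed graph on vertex set $\{0,1,\dots,8\}$, where vertex $v$ belongs to gender class $v \bmod 3$, with the following $16$ ranked edges. Rank $1$: $(0,1)$, $(1,2)$, $(2,3)$, $(3,4)$, $(4,5)$, $(5,0)$, $(6,4)$, $(7,8)$, $(8,0)$. Rank $2$: $(4,8)$, $(8,6)$, $(0,7)$, $(1,5)$, $(5,3)$, $(3,1)$. Rank $3$: $(4,2)$. Then this instance of 3DSMI of dimension $3$ has no stable matching.
   Context: An instance of 3DSMI of dimension $n$ is a directed graph $G$ without multiple edges whose vertex set is partitioned into three gender classes of size $n$ each, cyclically ordered (men $\to$ women $\to$ dogs $\to$ men), with every edge going from a class to the next class in this cyclic order (here from class $i$ to class $i+1 \bmod 3$). Each edge $(v,v')$ carries a positive integer rank $r(v,v')$, and for every vertex $v$ of out-degree $k$ the ranks of edges leaving $v$ are exactly $1,\dots,k$. A family is a directed $3$-cycle of $G$. A matching $\mathcal M$ is a set of pairwise vertex-disjoint families. For a vertex $v$, $R_{\mathcal M}(v)$ is the rank of the edge leaving $v$ within its family in $\mathcal M$, and $R_{\mathcal M}(v)=+\infty$ if $v$ lies in no family of $\mathcal M$. A directed $3$-cycle $(v,v',v'')$ of $G$ is blocking for $\mathcal M$ if $r(v,v')<R_{\mathcal M}(v)$, $r(v',v'')<R_{\mathcal M}(v')$ and $r(v'',v)<R_{\mathcal M}(v'')$. A matching is stable if it has no blocking triple. -}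

module Defs where

open import Data.Nat using (ℕ; zero; suc; _<_)
open import Data.Fin using (Fin; toℕ)
open import Data.Fin.Patterns
open import Data.Product using (Σ; _×_; _,_; ∃-syntax)
open import Data.Sum using (_⊎_)
open import Data.List using (List; []; _∷_)
open import Data.List.Membership.Propositional using (_∈_)
open import Data.List.Relation.Unary.All using (All)
open import Data.List.Relation.Unary.AllPairs using (AllPairs)
open import Relation.Binary.PropositionalEquality using (_≡_; _≢_)
open import Relation.Nullary using (¬_)

-- A ranked directed graph on vertex set Fin V: rank u v = 0 means "no edge",
-- rank u v = k ≥ 1 means the edge (u,v) exists with rank k.
RankFn : ℕ → Set
RankFn V = Fin V → Fin V → ℕ

Edge : ∀ {V} → RankFn V → Fin V → Fin V → Set
Edge r u v = 0 < r u v

Triple : ℕ → Set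
Triple V = Fin V × Fin V × Fin V

IsFamily : ∀ {V} → RankFn V → Triple V → Set
IsFamily r (a , b , c) = Edge r a b × Edge r b c × Edge r c a

_∈T_ : ∀ {V} → Fin V → Triple V → Set
v ∈T (a , b , c) = (v ≡ a) ⊎ (v ≡ b) ⊎ (v ≡ c)

Disjoint : ∀ {V} → Triple V → Triple V → Set
Disjoint t s = ∀ v → v ∈T t → ¬ (v ∈T s)

record Matching {V} (r : RankFn V) : Set where
  constructor mkMatching
  field
    families : List (Triple V)
    areFamilies : All (IsFamily r) families
    disjoint : AllPairs Disjoint families
open Matching public

OutRankIn : ∀ {V} → RankFn V → Triple V → Fin V → ℕ → Set
OutRankIn r (a , b , c) v k =
  (v ≡ a × r a b ≡ k) ⊎ (v ≡ b × r b c ≡ k) ⊎ (v ≡ c × r c a ≡ k)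

HasRank : ∀ {V} {r : RankFn V} → Matching r → Fin V → ℕ → Set
HasRank {r = r} M v k = ∃[ t ] (t ∈ families M × OutRankIn r t v k)

LtR : ∀ {V} {r : RankFn V} → Matching r → Fin V → ℕ → Set
LtR M v k = ∀ m → HasRank M v m → k < m

Blocking : ∀ {V} {r : RankFn V} → Matching r → Triple V → Set
Blocking {r = r} M (a , b , c) =
  IsFamily r (a , b , c) × LtR M a (r a b) × LtR M b (r b c) × LtR M c (r c a)

Stable : ∀ {V} {r : RankFn V} → Matching r → Set
Stable M = ∀ t → ¬ Blocking M t

G₃ : RankFn 9
G₃ 0F 1F = 1
G₃ 1F 2F = 1
G₃ 2F 3F = 1
G₃ 3F 4F = 1
G₃ 4F 5F = 1
G₃ 5F 0F = 1
G₃ 6F 4F = 1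
G₃ 7F 8F = 1
G₃ 8F 0F = 1
G₃ 4F 8F = 2
G₃ 8F 6F = 2
G₃ 0F 7F = 2
G₃ 1F 5F = 2
G₃ 5F 3F = 2
G₃ 3F 1F = 2
G₃ 4F 2F = 3
G₃ _ _ = 0

module Submission where

-- Stability forces every directed 3-cycle X of G to be covered by a family of M: some vertex of X
-- is at least as well off in that family as in X, for otherwise X would block M. Every family of
-- G₃ is a rotation of one of seven 3-cycles, so M determines a vertex-disjoint selection among
-- these seven cycles covering all seven. Only (0,1,5) and (0,7,8) cover (0,7,8), and in each case
-- following which cycles can still cover the remaining ones leads, in two more steps, to two
-- selected cycles sharing a vertex.

open import Defs
open import Data.Nat using (ℕ; z<s; _≤_; _<?_; _≤?_)
open import Data.Nat.Properties using (≰⇒>)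
open import Data.Fin using (Fin)
open import Data.Fin.Patterns
open import Data.Fin.Properties using (_≟_; all?)
open import Data.Product using (∃-syntax; _,_; _×_; proj₂; map₂)
open import Data.Product.Properties using (≡-dec)
open import Data.Sum using (_⊎_; inj₁; inj₂)
open import Data.Empty using (⊥; ⊥-elim)
open import Data.List using (List; []; _∷_)
open import Data.List.Membership.Propositional using (_∈_; find; lose)
open import Data.List.Relation.Unary.Any using (Any; here; there)
import Data.List.Relation.Unary.Any as Any
open import Data.List.Relation.Unary.All using (lookup)
open import Data.List.Relation.Unary.AllPairs using (AllPairs; _∷_)
open import Relation.Binary.Definitions using (DecidableEquality)
open import Relation.Binary.PropositionalEquality using (_≡_; refl)
open import Relation.Nullary using (¬_; yes; no)
open import Relation.Nullary.Decidable
  using (Dec; True; False; _×-dec_; _⊎-dec_; _→-dec_; toWitness; fromWitness; toWitnessFalse)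

module _ {V : ℕ} where

  rotate : Triple V → Triple V
  rotate (a , b , c) = (b , c , a)

  infix 4 _≈ᶜ_

  _≈ᶜ_ : Triple V → Triple V → Set
  s ≈ᶜ t = s ≡ t ⊎ s ≡ rotate t ⊎ s ≡ rotate (rotate t)

  ≈ᶜ-sym : ∀ {s t} → s ≈ᶜ t → t ≈ᶜ s
  ≈ᶜ-sym (inj₁ refl) = inj₁ refl
  ≈ᶜ-sym (inj₂ (inj₁ refl)) = inj₂ (inj₂ refl)
  ≈ᶜ-sym (inj₂ (inj₂ refl)) = inj₂ (inj₁ refl)

  ≈ᶜ-trans : ∀ {s t u} → s ≈ᶜ t → t ≈ᶜ u → s ≈ᶜ u
  ≈ᶜ-trans (inj₁ refl) q = q
  ≈ᶜ-trans (inj₂ (inj₁ refl)) (inj₁ refl) = inj₂ (inj₁ refl)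
  ≈ᶜ-trans (inj₂ (inj₁ refl)) (inj₂ (inj₁ refl)) = inj₂ (inj₂ refl)
  ≈ᶜ-trans (inj₂ (inj₁ refl)) (inj₂ (inj₂ refl)) = inj₁ refl
  ≈ᶜ-trans (inj₂ (inj₂ refl)) (inj₁ refl) = inj₂ (inj₂ refl)
  ≈ᶜ-trans (inj₂ (inj₂ refl)) (inj₂ (inj₁ refl)) = inj₁ refl
  ≈ᶜ-trans (inj₂ (inj₂ refl)) (inj₂ (inj₂ refl)) = inj₂ (inj₁ refl)

  ∈T-rotate : ∀ {v t} → v ∈T t → v ∈T rotate t
  ∈T-rotate (inj₁ v≡a) = inj₂ (inj₂ v≡a)
  ∈T-rotate (inj₂ (inj₁ v≡b)) = inj₁ v≡b
  ∈T-rotate (inj₂ (inj₂ v≡c)) = inj₂ (inj₁ v≡c)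

  ∈T-resp-≈ᶜ : ∀ {v s t} → s ≈ᶜ t → v ∈T t → v ∈T s
  ∈T-resp-≈ᶜ (inj₁ refl) v∈t = v∈t
  ∈T-resp-≈ᶜ (inj₂ (inj₁ refl)) v∈t = ∈T-rotate v∈t
  ∈T-resp-≈ᶜ (inj₂ (inj₂ refl)) v∈t = ∈T-rotate (∈T-rotate v∈t)

  _∈T?_ : (v : Fin V) (t : Triple V) → Dec (v ∈T t)
  v ∈T? (a , b , c) = v ≟ a ⊎-dec v ≟ b ⊎-dec v ≟ c

  _≟ᵗ_ : DecidableEquality (Triple V)
  _≟ᵗ_ = ≡-dec _≟_ (≡-dec _≟_ _≟_)

  _≈ᶜ?_ : (s t : Triple V) → Dec (s ≈ᶜ t)
  s ≈ᶜ? t = s ≟ᵗ t ⊎-dec s ≟ᵗ rotate t ⊎-dec s ≟ᵗ rotate (rotate t)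

  shared-vertex⇒≡ : ∀ {L s s' u} → AllPairs (Disjoint {V}) L → s ∈ L → s' ∈ L → u ∈T s → u ∈T s' → s ≡ s'
  shared-vertex⇒≡ (_ ∷ _) (here refl) (here refl) _ _ = refl
  shared-vertex⇒≡ (disj ∷ _) (here refl) (there s'∈L) u∈s u∈s' = ⊥-elim (lookup disj s'∈L _ u∈s u∈s')
  shared-vertex⇒≡ (disj ∷ _) (there s∈L) (here refl) u∈s u∈s' = ⊥-elim (lookup disj s∈L _ u∈s' u∈s)
  shared-vertex⇒≡ (_ ∷ disj) (there s∈L) (there s'∈L) u∈s u∈s' = shared-vertex⇒≡ disj s∈L s'∈L u∈s u∈s'

module Ranked {V : ℕ} (r : RankFn V) where

  RankAtMost : Triple V → Fin V → ℕ → Set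
  RankAtMost (a , b , c) v k = v ≡ a × r a b ≤ k ⊎ v ≡ b × r b c ≤ k ⊎ v ≡ c × r c a ≤ k

  infix 4 _≽_

  _≽_ : Triple V → Triple V → Set
  s ≽ (a , b , c) = RankAtMost s a (r a b) ⊎ RankAtMost s b (r b c) ⊎ RankAtMost s c (r c a)

  rankAtMost? : ∀ t v k → Dec (RankAtMost t v k)
  rankAtMost? (a , b , c) v k = v ≟ a ×-dec r a b ≤? k ⊎-dec v ≟ b ×-dec r b c ≤? k ⊎-dec v ≟ c ×-dec r c a ≤? k

  _≽?_ : (s t : Triple V) → Dec (s ≽ t)
  s ≽? (a , b , c) = rankAtMost? s a (r a b) ⊎-dec rankAtMost? s b (r b c) ⊎-dec rankAtMost? s c (r c a)

  isFamily? : (t : Triple V) → Dec (IsFamily r t)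
  isFamily? (a , b , c) = 0 <? r a b ×-dec 0 <? r b c ×-dec 0 <? r c a

  outRankIn⇒rankAtMost : ∀ {t v m k} → OutRankIn r t v m → m ≤ k → RankAtMost t v k
  outRankIn⇒rankAtMost (inj₁ (v≡a , refl)) m≤k = inj₁ (v≡a , m≤k)
  outRankIn⇒rankAtMost (inj₂ (inj₁ (v≡b , refl))) m≤k = inj₂ (inj₁ (v≡b , m≤k))
  outRankIn⇒rankAtMost (inj₂ (inj₂ (v≡c , refl))) m≤k = inj₂ (inj₂ (v≡c , m≤k))

  rankAtMost-rotate : ∀ {t v k} → RankAtMost (rotate t) v k → RankAtMost t v k
  rankAtMost-rotate (inj₁ p) = inj₂ (inj₁ p)
  rankAtMost-rotate (inj₂ (inj₁ p)) = inj₂ (inj₂ p)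
  rankAtMost-rotate (inj₂ (inj₂ p)) = inj₁ p

  rankAtMost-resp-≈ᶜ : ∀ {s t v k} → s ≈ᶜ t → RankAtMost s v k → RankAtMost t v k
  rankAtMost-resp-≈ᶜ (inj₁ refl) p = p
  rankAtMost-resp-≈ᶜ (inj₂ (inj₁ refl)) p = rankAtMost-rotate p
  rankAtMost-resp-≈ᶜ (inj₂ (inj₂ refl)) p = rankAtMost-rotate (rankAtMost-rotate p)

  ≽-resp-≈ᶜ : ∀ {s s' t} → s ≈ᶜ s' → s ≽ t → s' ≽ t
  ≽-resp-≈ᶜ s≈s' (inj₁ p) = inj₁ (rankAtMost-resp-≈ᶜ s≈s' p)
  ≽-resp-≈ᶜ s≈s' (inj₂ (inj₁ p)) = inj₂ (inj₁ (rankAtMost-resp-≈ᶜ s≈s' p))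
  ≽-resp-≈ᶜ s≈s' (inj₂ (inj₂ p)) = inj₂ (inj₂ (rankAtMost-resp-≈ᶜ s≈s' p))

  ltR⊎rankAtMost : ∀ (M : Matching r) v k → LtR M v k ⊎ ∃[ s ] s ∈ families M × RankAtMost s v k
  ltR⊎rankAtMost M v k with Any.any? (λ s → rankAtMost? s v k) (families M)
  ... | yes found = inj₂ (find found)
  ... | no none = inj₁ λ m (t , t∈M , out) → ≰⇒> λ m≤k → none (lose t∈M (outRankIn⇒rankAtMost out m≤k))

  stable⇒∃≽ : ∀ {M : Matching r} {t} → Stable M → IsFamily r t → ∃[ s ] s ∈ families M × s ≽ t
  stable⇒∃≽ {M} {a , b , c} stable family
    with ltR⊎rankAtMost M a (r a b) | ltR⊎rankAtMost M b (r b c) | ltR⊎rankAtMost M c (r c a)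
  ... | inj₂ (s , s∈M , p) | _ | _ = s , s∈M , inj₁ p
  ... | inj₁ _ | inj₂ (s , s∈M , p) | _ = s , s∈M , inj₂ (inj₁ p)
  ... | inj₁ _ | inj₁ _ | inj₂ (s , s∈M , p) = s , s∈M , inj₂ (inj₂ p)
  ... | inj₁ a-better | inj₁ b-better | inj₁ c-better =
    ⊥-elim (stable (a , b , c) (family , a-better , b-better , c-better))

  OccursIn : Matching r → Triple V → Set
  OccursIn M t = ∃[ s ] s ∈ families M × s ≈ᶜ t

  occurrences-overlap⇒≈ᶜ : ∀ {M t t' u} → OccursIn M t → OccursIn M t' → u ∈T t → u ∈T t' → t ≈ᶜ t'
  occurrences-overlap⇒≈ᶜ {M} (s , s∈M , s≈t) (s' , s'∈M , s'≈t') u∈t u∈t'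
    with shared-vertex⇒≡ (disjoint M) s∈M s'∈M (∈T-resp-≈ᶜ s≈t u∈t) (∈T-resp-≈ᶜ s'≈t' u∈t')
  ... | refl = ≈ᶜ-trans (≈ᶜ-sym s≈t) s'≈t'

open Ranked G₃

data Cycle : Set where
  c015 c078 c123 c153 c345 c342 c486 : Cycle

cycles : List Cycle
cycles = c015 ∷ c078 ∷ c123 ∷ c153 ∷ c345 ∷ c342 ∷ c486 ∷ []

cycle : Cycle → Triple 9
cycle c015 = 0F , 1F , 5F
cycle c078 = 0F , 7F , 8F
cycle c123 = 1F , 2F , 3F
cycle c153 = 1F , 5F , 3F
cycle c345 = 3F , 4F , 5F
cycle c342 = 3F , 4F , 2F
cycle c486 = 4F , 8F , 6F

cycle-isFamily : ∀ X → IsFamily G₃ (cycle X)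
cycle-isFamily c015 = z<s , z<s , z<s
cycle-isFamily c078 = z<s , z<s , z<s
cycle-isFamily c123 = z<s , z<s , z<s
cycle-isFamily c153 = z<s , z<s , z<s
cycle-isFamily c345 = z<s , z<s , z<s
cycle-isFamily c342 = z<s , z<s , z<s
cycle-isFamily c486 = z<s , z<s , z<s

family⇒cycle : ∀ s → IsFamily G₃ s → ∃[ X ] s ≈ᶜ cycle X
family⇒cycle (a , b , c) family = map₂ proj₂ (find (classification a b c family))
  where
  classification : ∀ a b c → IsFamily G₃ (a , b , c) → Any (λ X → (a , b , c) ≈ᶜ cycle X) cycles
  classification = toWitness {a? = all? λ a → all? λ b → all? λ c →
    isFamily? (a , b , c) →-dec Any.any? (λ X → (a , b , c) ≈ᶜ? cycle X) cycles} _

-- Stated through the decision procedure: for a non-covering pair this is T false, so the coverage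
-- checker discards such cases in no-coveringPacking.
_covers_ : Cycle → Cycle → Set
Y covers X = True (cycle Y ≽? cycle X)

record CoveringPacking : Set₁ where
  field
    Chosen : Cycle → Set
    chosen-disjoint : ∀ {X Y} → Chosen X → Chosen Y → (u : Fin 9) →
                      {True (u ∈T? cycle X)} → {True (u ∈T? cycle Y)} → cycle X ≈ᶜ cycle Y
    covering : ∀ X → ∃[ Y ] Chosen Y × Y covers X

  -- At concrete X, Y and u the implicit arguments are solved by evaluation.
  clash : ∀ {X Y} → Chosen X → Chosen Y → (u : Fin 9) →
          {True (u ∈T? cycle X)} → {True (u ∈T? cycle Y)} → {False (cycle X ≈ᶜ? cycle Y)} → ⊥
  clash x y u {u∈X} {u∈Y} {X≉Y} = toWitnessFalse X≉Y (chosen-disjoint x y u {u∈X} {u∈Y})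

module _ (P : CoveringPacking) where
  open CoveringPacking P

  no-coveringPacking : ⊥
  no-coveringPacking with covering c078
  ... | c015 , o015 , _ with covering c342
  ...   | c123 , o , _ = clash o015 o 1F
  ...   | c345 , o , _ = clash o015 o 5F
  ...   | c342 , o342 , _ with covering c486
  ...     | c078 , o , _ = clash o015 o 0F
  ...     | c345 , o , _ = clash o015 o 5F
  ...     | c486 , o , _ = clash o342 o 4F
  no-coveringPacking | c015 , o015 , _ | c486 , o486 , _ with covering c123
  ...     | c123 , o , _ = clash o015 o 1F
  ...     | c153 , o , _ = clash o015 o 1F
  ...     | c345 , o , _ = clash o015 o 5F
  ...     | c342 , o , _ = clash o486 o 4F
  no-coveringPacking | c078 , o078 , _ with covering c015
  ...   | c015 , o , _ = clash o078 o 0F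
  ...   | c123 , o123 , _ with covering c345
  ...     | c015 , o , _ = clash o078 o 0F
  ...     | c153 , o , _ = clash o123 o 1F
  ...     | c345 , o , _ = clash o123 o 3F
  ...     | c342 , o , _ = clash o123 o 2F
  no-coveringPacking | c078 , o078 , _ | c153 , o153 , _ with covering c342
  ...     | c123 , o , _ = clash o153 o 1F
  ...     | c345 , o , _ = clash o153 o 3F
  ...     | c342 , o , _ = clash o153 o 3F
  ...     | c486 , o , _ = clash o078 o 8F

covered-by-occurrence : (M : Matching G₃) → Stable M → ∀ X → ∃[ Y ] OccursIn M (cycle Y) × Y covers X
covered-by-occurrence M stable X =
  let s , s∈M , s≽X = stable⇒∃≽ {M} stable (cycle-isFamily X)
      Y , s≈Y = family⇒cycle s (lookup (areFamilies M) s∈M)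
  in Y , (s , s∈M , s≈Y) , fromWitness (≽-resp-≈ᶜ s≈Y s≽X)

stable⇒coveringPacking : (M : Matching G₃) → Stable M → CoveringPacking
stable⇒coveringPacking M stable = record
  { Chosen = λ X → OccursIn M (cycle X)
  ; chosen-disjoint = λ x y u {u∈X} {u∈Y} → occurrences-overlap⇒≈ᶜ {M = M} x y (toWitness u∈X) (toWitness u∈Y)
  ; covering = covered-by-occurrence M stable
  }

theorem3 : ¬ (∃[ M ] Stable {r = G₃} M)
theorem3 (M , stable) = no-coveringPacking (stable⇒coveringPacking M stable)
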